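{- Let $p \geq 4$ and let $q$ be an integer with $q_{\text{quad}}(p) < q \leq \binom{p}{2}$. Set $e := \binom{p}{2} - q + 1$. If $f_4(n,p,e) = o(n^2)$, then $g(n,p,q) = \binom{n}{2} - o(n^2)$.
   Context: $g(n,p,q)$ denotes the minimum number of colors in a coloring of the edges of the complete graph $K_n$ in which every copy of $K_p$ receives at least $q$ distinct colors. $q_{\text{quad}}(p) := \binom{p}{2} - \lfloor p/2 \rfloor + 2$. A $(v,e)$-configuration is a hypergraph with exactly $e$ edges and at most $v$ vertices; $f_4(n,v,e)$ denotes the largest number of edges in an $n$-vertex $4$-uniform hypergraph containing no $(v,e)$-configuration (i.e. no $e$ edges whose union has at most $v$ vertices). Asymptotics are as $n\to\infty$ with $p,q$ fixed. -}

module Defs where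

open import Data.Nat using (ℕ; _+_; _*_; _∸_; _≤_; _<_)
open import Data.Nat.DivMod using (_/_)
open import Data.Nat.Combinatorics using (_C_)
open import Data.Fin using (Fin)
open import Data.Fin.Properties using (any?) renaming (_≟_ to _≟ᶠ_; _<?_ to _<ᶠ?_)
open import Data.Fin.Subset using (Subset; ∣_∣; ⋃; _∈_)
open import Data.Fin.Subset.Properties using (_∈?_)
open import Data.Vec using (tabulate)
open import Data.List using (List; length)
open import Data.List.Relation.Unary.All using (All)
open import Data.List.Relation.Unary.Unique.Propositional using (Unique)
open import Data.List.Relation.Binary.Subset.Propositional using (_⊆_)
open import Data.Product using (Σ; ∃; ∃-syntax; _×_)
open import Relation.Nullary using (does; ¬_)
open import Relation.Nullary.Decidable using (_×-dec_)
open import Relation.Binary.PropositionalEquality using (_≡_)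

qquad : ℕ → ℕ
qquad p = ((p C 2) ∸ (p / 2)) + 2

-- Edge colourings of K_n with colours from Fin m.
-- A colouring is a symmetric function c : Fin n → Fin n → Fin m;
-- the edge {i,j} (i ≢ j) gets colour c i j (diagonal values are ignored).

Symmetric : ∀ {n m} → (Fin n → Fin n → Fin m) → Set
Symmetric c = ∀ i j → c i j ≡ c j i

colorsOn : ∀ {n m} → (Fin n → Fin n → Fin m) → Subset n → Subset m
colorsOn c S = tabulate λ x →
  does (any? λ i → any? λ j →
          (i ∈? S) ×-dec ((j ∈? S) ×-dec ((i <ᶠ? j) ×-dec (c i j ≟ᶠ x))))

Good : ∀ {n m} → ℕ → ℕ → (Fin n → Fin n → Fin m) → Set
Good {n} p q c = (S : Subset n) → ∣ S ∣ ≡ p → q ≤ ∣ colorsOn c S ∣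

ColoringWith : ℕ → ℕ → ℕ → ℕ → Set
ColoringWith n p q m = Σ (Fin n → Fin n → Fin m) λ c → Symmetric c × Good p q c

-- IsG n p q m  :⇔  m = g(n,p,q)  (the minimum number of colours)
IsG : ℕ → ℕ → ℕ → ℕ → Set
IsG n p q m = ColoringWith n p q m × (∀ m' → ColoringWith n p q m' → m ≤ m')

record Hypergraph4 (n : ℕ) : Set where
  field
    edges   : List (Subset n)
    unique  : Unique edges
    uniform : All (λ E → ∣ E ∣ ≡ 4) edges
open Hypergraph4 public

HasConfig : ∀ {n} → ℕ → ℕ → Hypergraph4 n → Set
HasConfig {n} v e H =
  Σ (List (Subset n)) λ L → (L ⊆ edges H × Unique L × length L ≡ e × ∣ ⋃ L ∣ ≤ v)

-- IsF4 n v e m  :⇔  m = f_4(n,v,e)  (the maximum number of edges)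
IsF4 : ℕ → ℕ → ℕ → ℕ → Set
IsF4 n v e m =
  (Σ (Hypergraph4 n) λ H → (¬ HasConfig v e H × length (edges H) ≡ m)) ×
  (∀ (H : Hypergraph4 n) → ¬ HasConfig v e H → length (edges H) ≤ m)

module Submission where

-- Fix a colouring c of K_n with m colours in which every
-- p-set of vertices sees at least q colours.  In every colour class call the
-- first edge (in a fixed enumeration of the edges) its representative; all
-- other edges are redundant, so there are at least C(n,2) - m redundant edges.
-- A redundant edge f and its representative rep f span at most four vertices;
-- padding gives a 4-set quad f.  The quads form a 4-uniform hypergraph H with
-- at least (C(n,2) - m)/6 edges, since a 4-set contains only six pairs.
-- H has no (p, e)-configuration, e = C(p,2) - q + 1: if e distinct quads lie in
-- a p-set S, the e redundant edges behind them lie in S together with their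
-- representatives, which are not redundant; so S sees at most C(p,2) - e < q
-- colours.  Hence C(n,2) - g(n,p,q) ≤ 6 f_4(n,p,e), and f_4 = o(n²) gives the
-- claim.  The maximum f_4(n,p,e) is obtained under a double negation, which is
-- harmless because the goal is a decidable inequality.  The argument only
-- needs q ≤ C(p,2).

open import Defs
open import Data.Nat using (ℕ; zero; suc; _+_; _*_; _∸_; _≤_; _<_; _⊔_; z≤n; s≤s; _≤?_)
open import Data.Nat.Properties
open import Data.Nat.Combinatorics using (_C_; nCk+nC[k+1]≡[n+1]C[k+1]; nC1≡n)
open import Data.Bool using (true; false)
open import Data.Fin using (Fin; zero; suc) renaming (_<_ to _<ᶠ_)
open import Data.Fin.Properties using (any?; ¬∀⟶∃¬) renaming (_≟_ to _≟ᶠ_; _<?_ to _<ᶠ?_; suc-injective to suc-injectiveᶠ)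
open import Data.Fin.Subset using (Subset; ∣_∣; ⋃; _∪_; ⁅_⁆; ⊥; ⊤) renaming (_∈_ to _∈ₛ_; _∉_ to _∉ₛ_; _⊆_ to _⊆ₛ_)
open import Data.Fin.Subset.Properties using (x∈p∪q⁻; x∈⁅x⁆; x∈⁅y⁆⇒x≡y; ∣⊤∣≡n; ∈⊤; p⊆q⇒∣p∣≤∣q∣; p⊆p∪q; q⊆p∪q; ∉⊥; ∪-identityʳ) renaming (_∈?_ to _∈ₛ?_)
open import Data.Vec using ([]; _∷_; here; there)
open import Data.Vec.Properties using ([]=⇒lookup; lookup∘tabulate) renaming (≡-dec to ≡-decᵛ)
open import Data.Bool.Properties using () renaming (_≟_ to _≟ᵇ_)
open import Data.List using (List; []; _∷_; length; map; _++_; filter; concatMap; deduplicate)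
open import Data.List.Properties using (length-++; length-map)
open import Data.List.Membership.Propositional using (_∈_; _∉_; lose)
open import Data.List.Membership.Propositional.Properties using (∈-∃++; ∈-++⁻; ∈-++⁺ˡ; ∈-++⁺ʳ; ∈-map⁺; ∈-map⁻; ∈-filter⁺; ∈-filter⁻; ∈-concatMap⁺; ∈-deduplicate⁺; ∈-deduplicate⁻)
open import Data.List.Relation.Unary.Any using (here; there)
open import Data.List.Relation.Unary.All using (All; []; _∷_) renaming (lookup to All-lookup; tabulate to All-tabulate)
open import Data.List.Relation.Unary.Unique.Propositional using (Unique)
open import Data.List.Relation.Unary.AllPairs using ([]; _∷_)
open import Data.List.Relation.Unary.Unique.Propositional.Properties using (map⁺; ++⁺; filter⁺)
open import Data.List.Relation.Unary.Unique.DecPropositional.Properties using (deduplicate-!)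
open import Data.Product using (Σ; ∃; ∃-syntax; _×_; _,_; proj₁; proj₂)
open import Data.Product.Properties using () renaming (≡-dec to ≡-decˣ)
open import Data.Sum using (inj₁; inj₂)
open import Data.Empty using (⊥-elim)
open import Function using (id)
open import Relation.Nullary using (¬_; Dec; yes; no; does; ¬?)
open import Relation.Nullary.Negation using (¬¬-map)
open import Relation.Nullary.Decidable using (_×-dec_; decidable-stable)
open import Relation.Unary using (Decidable)
open import Relation.Binary.Definitions using (DecidableEquality)
open import Relation.Binary.PropositionalEquality using (_≡_; _≢_; refl; sym; trans; cong; cong₂; subst)

module _ {a} {A : Set a} where

  ∈-delete : ∀ {x y : A} (us vs : List A) → y ≢ x → y ∈ us ++ x ∷ vs → y ∈ us ++ vs
  ∈-delete []       vs y≢x (here y≡x) = ⊥-elim (y≢x y≡x)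
  ∈-delete []       vs y≢x (there y∈) = y∈
  ∈-delete (u ∷ us) vs y≢x (here y≡u) = here y≡u
  ∈-delete (u ∷ us) vs y≢x (there y∈) = there (∈-delete us vs y≢x y∈)

  length-insert : ∀ (x : A) (us vs : List A) → length (us ++ x ∷ vs) ≡ suc (length (us ++ vs))
  length-insert x []       vs = refl
  length-insert x (u ∷ us) vs = cong suc (length-insert x us vs)

  unique⊆⇒length≤ : ∀ {xs ys : List A} → Unique xs → (∀ {x} → x ∈ xs → x ∈ ys) →
    length xs ≤ length ys
  unique⊆⇒length≤ {[]}     _           _   = z≤n
  unique⊆⇒length≤ {x ∷ xs} (x∉xs ∷ u) sub with ∈-∃++ (sub (here refl))
  ... | us , vs , refl = begin
    suc (length xs)         ≤⟨ s≤s (unique⊆⇒length≤ u xs⊆us++vs) ⟩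
    suc (length (us ++ vs)) ≡⟨ sym (length-insert x us vs) ⟩
    length (us ++ x ∷ vs)   ∎
    where
    open ≤-Reasoning
    xs⊆us++vs : ∀ {y} → y ∈ xs → y ∈ us ++ vs
    xs⊆us++vs y∈ = ∈-delete us vs (λ y≡x → All-lookup x∉xs y∈ (sym y≡x)) (sub (there y∈))

  length-partition : ∀ {p} {P : A → Set p} (P? : Decidable P) (xs : List A) →
    length (filter P? xs) + length (filter (λ x → ¬? (P? x)) xs) ≡ length xs
  length-partition P? []       = refl
  length-partition P? (x ∷ xs) with P? x
  ... | yes _ = cong suc (length-partition P? xs)
  ... | no  _ = trans (+-suc _ _) (cong suc (length-partition P? xs))

  map-unique : ∀ {b} {B : Set b} (f : A → B) {xs : List A} → Unique xs →
    (∀ {x y} → x ∈ xs → y ∈ xs → f x ≡ f y → x ≡ y) → Unique (map f xs)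
  map-unique f {[]}     []          inj = []
  map-unique f {x ∷ xs} (x∉xs ∷ u) inj =
    All-tabulate fx∉ ∷ map-unique f u (λ x∈ y∈ → inj (there x∈) (there y∈))
    where
    fx∉ : ∀ {z} → z ∈ map f xs → f x ≢ z
    fx∉ z∈ fx≡z with ∈-map⁻ f z∈
    ... | y , y∈ , refl = All-lookup x∉xs y∈ (inj (here refl) (there y∈) fx≡z)

  length-concatMap : ∀ {b} {B : Set b} (g : B → List A) (k : ℕ) (xs : List B) →
    All (λ x → length (g x) ≡ k) xs → length (concatMap g xs) ≡ k * length xs
  length-concatMap g k []       []         = sym (*-zeroʳ k)
  length-concatMap g k (x ∷ xs) (gx ∷ gxs) = begin
    length (g x ++ concatMap g xs)        ≡⟨ length-++ (g x) ⟩
    length (g x) + length (concatMap g xs) ≡⟨ cong₂ _+_ gx (length-concatMap g k xs gxs) ⟩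
    k + k * length xs                      ≡⟨ sym (*-suc k (length xs)) ⟩
    k * suc (length xs)                    ∎
    where open Relation.Binary.PropositionalEquality.≡-Reasoning

elements : ∀ {n} → Subset n → List (Fin n)
elements []          = []
elements (true ∷ S)  = zero ∷ map suc (elements S)
elements (false ∷ S) = map suc (elements S)

∈-elements⁺ : ∀ {n} {S : Subset n} {x} → x ∈ₛ S → x ∈ elements S
∈-elements⁺ {S = true ∷ S}  here       = here refl
∈-elements⁺ {S = true ∷ S}  (there x∈) = there (∈-map⁺ suc (∈-elements⁺ x∈))
∈-elements⁺ {S = false ∷ S} (there x∈) = ∈-map⁺ suc (∈-elements⁺ x∈)

∈-elements⁻ : ∀ {n} {S : Subset n} {x} → x ∈ elements S → x ∈ₛ S
∈-elements⁻ {S = true ∷ S} (here refl) = here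
∈-elements⁻ {S = true ∷ S} (there x∈) with ∈-map⁻ suc x∈
... | y , y∈ , refl = there (∈-elements⁻ y∈)
∈-elements⁻ {S = false ∷ S} x∈ with ∈-map⁻ suc x∈
... | y , y∈ , refl = there (∈-elements⁻ y∈)

elements-unique : ∀ {n} (S : Subset n) → Unique (elements S)
elements-unique []          = []
elements-unique {suc n} (true ∷ S) = All-tabulate zero∉ ∷ map⁺ suc-injectiveᶠ (elements-unique S)
  where
  zero∉ : ∀ {z : Fin (suc n)} → z ∈ map suc (elements S) → zero ≢ z
  zero∉ z∈ zero≡z with ∈-map⁻ suc z∈
  zero∉ z∈ () | _ , _ , refl
elements-unique (false ∷ S) = map⁺ suc-injectiveᶠ (elements-unique S)

length-elements : ∀ {n} (S : Subset n) → length (elements S) ≡ ∣ S ∣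
length-elements []          = refl
length-elements (true ∷ S)  = cong suc (trans (length-map suc (elements S)) (length-elements S))
length-elements (false ∷ S) = trans (length-map suc (elements S)) (length-elements S)

∣∣≤length : ∀ {n} {T : Subset n} {ys : List (Fin n)} → (∀ {x} → x ∈ₛ T → x ∈ ys) →
  ∣ T ∣ ≤ length ys
∣∣≤length {T = T} T⊆ys = subst (_≤ _) (length-elements T)
  (unique⊆⇒length≤ (elements-unique T) (λ x∈ → T⊆ys (∈-elements⁻ x∈)))

unique⇒length≤n : ∀ {n} {xs : List (Fin n)} → Unique xs → length xs ≤ n
unique⇒length≤n {n} {xs} u = subst (length xs ≤_) (trans (length-elements (⊤ {n})) (∣⊤∣≡n n))
  (unique⊆⇒length≤ u (λ _ → ∈-elements⁺ ∈⊤))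

missing : ∀ {n} (T : Subset n) → ∣ T ∣ < n → ∃ λ x → x ∉ₛ T
missing {n} T ∣T∣<n = ¬∀⟶∃¬ n (_∈ₛ T) (_∈ₛ? T) λ T-full →
  <⇒≱ ∣T∣<n (subst (_≤ ∣ T ∣) (∣⊤∣≡n n) (p⊆q⇒∣p∣≤∣q∣ {p = ⊤} (λ {x} _ → T-full x)))

∣∪⁅x⁆∣ : ∀ {n} (S : Subset n) (x : Fin n) → x ∉ₛ S → ∣ S ∪ ⁅ x ⁆ ∣ ≡ suc ∣ S ∣
∣∪⁅x⁆∣ (true ∷ S)  zero    x∉ = ⊥-elim (x∉ here)
∣∪⁅x⁆∣ (false ∷ S) zero    x∉ = cong (λ T → suc ∣ T ∣) (∪-identityʳ S)
∣∪⁅x⁆∣ (true ∷ S)  (suc x) x∉ = cong suc (∣∪⁅x⁆∣ S x (λ x∈ → x∉ (there x∈)))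
∣∪⁅x⁆∣ (false ∷ S) (suc x) x∉ = ∣∪⁅x⁆∣ S x (λ x∈ → x∉ (there x∈))

pad : ∀ {n} (p : ℕ) (T : Subset n) → ∣ T ∣ ≤ p → p ≤ n → ∃ λ S → T ⊆ₛ S × ∣ S ∣ ≡ p
pad {n} p T ∣T∣≤p p≤n = add (p ∸ ∣ T ∣) T (m∸n+n≡m ∣T∣≤p)
  where
  add : ∀ k (T : Subset n) → k + ∣ T ∣ ≡ p → ∃ λ S → T ⊆ₛ S × ∣ S ∣ ≡ p
  add zero    T ∣T∣≡p = T , id , ∣T∣≡p
  add (suc k) T k+1+∣T∣≡p with missing T (<-≤-trans (subst (∣ T ∣ <_) k+1+∣T∣≡p (s≤s (m≤n+m ∣ T ∣ k))) p≤n)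
  ... | x , x∉T with add k (T ∪ ⁅ x ⁆) (trans (cong (k +_) (∣∪⁅x⁆∣ T x x∉T)) (trans (+-suc k ∣ T ∣) k+1+∣T∣≡p))
  ... | S , T∪x⊆S , ∣S∣≡p = S , (λ y∈ → T∪x⊆S (p⊆p∪q ⁅ x ⁆ y∈)) , ∣S∣≡p

∈⋃ : ∀ {n} {x : Fin n} {Q : Subset n} {L : List (Subset n)} → x ∈ₛ Q → Q ∈ L → x ∈ₛ ⋃ L
∈⋃ {L = Q ∷ L}  x∈ (here refl) = p⊆p∪q (⋃ L) x∈
∈⋃ {L = Q' ∷ L} x∈ (there Q∈)  = q⊆p∪q Q' (⋃ L) (∈⋃ x∈ Q∈)

fromList : ∀ {n} → List (Fin n) → Subset n
fromList []       = ⊥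
fromList (x ∷ xs) = fromList xs ∪ ⁅ x ⁆

fromList⁺ : ∀ {n} {x : Fin n} {xs} → x ∈ xs → x ∈ₛ fromList xs
fromList⁺ {xs = y ∷ xs} (here refl) = q⊆p∪q (fromList xs) ⁅ y ⁆ (x∈⁅x⁆ y)
fromList⁺ {xs = y ∷ xs} (there x∈)  = p⊆p∪q ⁅ y ⁆ (fromList⁺ x∈)

fromList⁻ : ∀ {n} {x : Fin n} xs → x ∈ₛ fromList xs → x ∈ xs
fromList⁻ []       x∈ = ⊥-elim (∉⊥ x∈)
fromList⁻ (y ∷ xs) x∈ with x∈p∪q⁻ (fromList xs) ⁅ y ⁆ x∈
... | inj₁ x∈xs = there (fromList⁻ xs x∈xs)
... | inj₂ x∈y  = here (x∈⁅y⁆⇒x≡y y x∈y)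

-- Edges of K_n are represented by pairs (i , j) with i < j.
Pair : ℕ → Set
Pair n = Fin n × Fin n

_≟ᵖ_ : ∀ {n} → DecidableEquality (Pair n)
_≟ᵖ_ = ≡-decˣ _≟ᶠ_ _≟ᶠ_

_≟ˢ_ : ∀ {n} → DecidableEquality (Subset n)
_≟ˢ_ = ≡-decᵛ _≟ᵇ_

fromZero : ∀ {n} → Fin n → Pair (suc n)
fromZero j = zero , suc j

shift : ∀ {n} → Pair n → Pair (suc n)
shift (i , j) = suc i , suc j

fromZero-injective : ∀ {n} {x y : Fin n} → fromZero x ≡ fromZero y → x ≡ y
fromZero-injective refl = refl

shift-injective : ∀ {n} {e f : Pair n} → shift e ≡ shift f → e ≡ f
shift-injective {e = _ , _} {f = _ , _} refl = refl

pairs : ∀ {n} → Subset n → List (Pair n)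
pairs []          = []
pairs (true ∷ S)  = map fromZero (elements S) ++ map shift (pairs S)
pairs (false ∷ S) = map shift (pairs S)

suc-C2 : ∀ k → suc k C 2 ≡ k + k C 2
suc-C2 k = trans (sym (nCk+nC[k+1]≡[n+1]C[k+1] k 1)) (cong (_+ k C 2) (nC1≡n k))

length-pairs : ∀ {n} (S : Subset n) → length (pairs S) ≡ ∣ S ∣ C 2
length-pairs []          = refl
length-pairs (true ∷ S)  = begin
  length (map fromZero (elements S) ++ map shift (pairs S))
    ≡⟨ length-++ (map fromZero (elements S)) ⟩
  length (map fromZero (elements S)) + length (map shift (pairs S))
    ≡⟨ cong₂ _+_ (trans (length-map fromZero (elements S)) (length-elements S))
                 (trans (length-map shift (pairs S)) (length-pairs S)) ⟩
  ∣ S ∣ + ∣ S ∣ C 2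
    ≡⟨ sym (suc-C2 ∣ S ∣) ⟩
  suc ∣ S ∣ C 2 ∎
  where open Relation.Binary.PropositionalEquality.≡-Reasoning
length-pairs (false ∷ S) = trans (length-map shift (pairs S)) (length-pairs S)

∈-pairs⁺ : ∀ {n} {S : Subset n} {i j : Fin n} → i ∈ₛ S → j ∈ₛ S → i <ᶠ j → (i , j) ∈ pairs S
∈-pairs⁺ {S = true ∷ S}  {zero}  {suc j} i∈ (there j∈) i<j =
  ∈-++⁺ˡ (∈-map⁺ fromZero (∈-elements⁺ j∈))
∈-pairs⁺ {S = true ∷ S}  {suc i} {suc j} (there i∈) (there j∈) (s≤s i<j) =
  ∈-++⁺ʳ (map fromZero (elements S)) (∈-map⁺ shift (∈-pairs⁺ i∈ j∈ i<j))
∈-pairs⁺ {S = false ∷ S} {suc i} {suc j} (there i∈) (there j∈) (s≤s i<j) =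
  ∈-map⁺ shift (∈-pairs⁺ i∈ j∈ i<j)

∈-pairs⁻ : ∀ {n} {S : Subset n} {i j : Fin n} → (i , j) ∈ pairs S → i ∈ₛ S × j ∈ₛ S × i <ᶠ j
∈-pairs⁻ {S = true ∷ S} ij∈ with ∈-++⁻ (map fromZero (elements S)) ij∈
... | inj₁ ij∈₁ with ∈-map⁻ fromZero ij∈₁
...   | j , j∈ , refl = here , there (∈-elements⁻ j∈) , s≤s z≤n
∈-pairs⁻ {S = true ∷ S} ij∈ | inj₂ ij∈₂ with ∈-map⁻ shift ij∈₂
...   | (i , j) , ij∈S , refl with ∈-pairs⁻ ij∈S
...     | i∈ , j∈ , i<j = there i∈ , there j∈ , s≤s i<j
∈-pairs⁻ {S = false ∷ S} ij∈ with ∈-map⁻ shift ij∈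
... | (i , j) , ij∈S , refl with ∈-pairs⁻ ij∈S
...   | i∈ , j∈ , i<j = there i∈ , there j∈ , s≤s i<j

pairs-unique : ∀ {n} (S : Subset n) → Unique (pairs S)
pairs-unique []          = []
pairs-unique (true ∷ S)  =
  ++⁺ (map⁺ fromZero-injective (elements-unique S)) (map⁺ shift-injective (pairs-unique S)) disjoint
  where
  disjoint : ∀ {v} → ¬ (v ∈ map fromZero (elements S) × v ∈ map shift (pairs S))
  disjoint (v∈₁ , v∈₂) with ∈-map⁻ fromZero v∈₁ | ∈-map⁻ shift v∈₂
  ... | _ , _ , refl | (_ , _) , _ , ()
pairs-unique (false ∷ S) = map⁺ shift-injective (pairs-unique S)

does⇒witness : ∀ {P : Set} (d : Dec P) → does d ≡ true → P
does⇒witness (yes p) _ = p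
does⇒witness (no _)  ()

colour-witness : ∀ {n m} (c : Fin n → Fin n → Fin m) (S : Subset n) {x} → x ∈ₛ colorsOn c S →
  ∃ λ i → ∃ λ j → (i , j) ∈ pairs S × c i j ≡ x
colour-witness c S {x} x∈
  with does⇒witness (any? λ i → any? λ j → (i ∈ₛ? S) ×-dec ((j ∈ₛ? S) ×-dec ((i <ᶠ? j) ×-dec (c i j ≟ᶠ x))))
                    (trans (sym (lookup∘tabulate _ x)) ([]=⇒lookup x∈))
... | i , j , i∈ , j∈ , i<j , cij≡x = i , j , ∈-pairs⁺ i∈ j∈ i<j , cij≡x

module Representatives {n m : ℕ} (c : Fin n → Fin n → Fin m) where

  colour : Pair n → Fin m
  colour (i , j) = c i j

  E : List (Pair n)
  E = pairs ⊤

  firstOfColour : Fin m → Pair n → List (Pair n) → Pair n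
  firstOfColour x d []       = d
  firstOfColour x d (g ∷ gs) with colour g ≟ᶠ x
  ... | yes _ = g
  ... | no  _ = firstOfColour x d gs

  firstOfColour-colour : ∀ x d gs → colour d ≡ x → colour (firstOfColour x d gs) ≡ x
  firstOfColour-colour x d []       d-col = d-col
  firstOfColour-colour x d (g ∷ gs) d-col with colour g ≟ᶠ x
  ... | yes g-col = g-col
  ... | no  _     = firstOfColour-colour x d gs d-col

  firstOfColour-default : ∀ x d d' {h} gs → h ∈ gs → colour h ≡ x →
    firstOfColour x d gs ≡ firstOfColour x d' gs
  firstOfColour-default x d d' (g ∷ gs) h∈ h-col with colour g ≟ᶠ x
  ... | yes _ = refl
  firstOfColour-default x d d' (g ∷ gs) (here refl) h-col | no ¬g-col = ⊥-elim (¬g-col h-col)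
  firstOfColour-default x d d' (g ∷ gs) (there h∈) h-col  | no _     = firstOfColour-default x d d' gs h∈ h-col

  firstOfColour-∈ : ∀ x d {h} gs → h ∈ gs → colour h ≡ x → firstOfColour x d gs ∈ gs
  firstOfColour-∈ x d (g ∷ gs) h∈ h-col with colour g ≟ᶠ x
  ... | yes _ = here refl
  firstOfColour-∈ x d (g ∷ gs) (here refl) h-col | no ¬g-col = ⊥-elim (¬g-col h-col)
  firstOfColour-∈ x d (g ∷ gs) (there h∈) h-col  | no _      = there (firstOfColour-∈ x d gs h∈ h-col)

  rep : Pair n → Pair n
  rep f = firstOfColour (colour f) f E

  rep-colour : ∀ f → colour (rep f) ≡ colour f
  rep-colour f = firstOfColour-colour (colour f) f E refl

  rep-∈ : ∀ {f} → f ∈ E → rep f ∈ E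
  rep-∈ {f} f∈ = firstOfColour-∈ (colour f) f E f∈ refl

  rep-determined : ∀ {f g} → f ∈ E → colour f ≡ colour g → rep f ≡ rep g
  rep-determined {f} {g} f∈ f~g =
    trans (firstOfColour-default (colour f) f g E f∈ refl) (cong (λ x → firstOfColour x g E) f~g)

  rep-idempotent : ∀ {f} → f ∈ E → rep (rep f) ≡ rep f
  rep-idempotent {f} f∈ = sym (rep-determined f∈ (sym (rep-colour f)))

  isRep? : (f : Pair n) → Dec (f ≡ rep f)
  isRep? f = f ≟ᵖ rep f

  Redundant : List (Pair n)
  Redundant = filter (λ f → ¬? (isRep? f)) E

  Redundant⁻ : ∀ {f} → f ∈ Redundant → f ∈ E × f ≢ rep f
  Redundant⁻ f∈ = ∈-filter⁻ (λ f → ¬? (isRep? f)) {xs = E} f∈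

  Redundant-unique : Unique Redundant
  Redundant-unique = filter⁺ (λ f → ¬? (isRep? f)) (pairs-unique ⊤)

  -- representatives have distinct colours, so there are at most m of them
  redundant-count : n C 2 ≤ m + length Redundant
  redundant-count = begin
    n C 2                                    ≡⟨ sym (trans (length-pairs (⊤ {n})) (cong (_C 2) (∣⊤∣≡n n))) ⟩
    length E                                 ≡⟨ sym (length-partition isRep? E) ⟩
    length Reps + length Redundant           ≤⟨ +-monoˡ-≤ (length Redundant) Reps≤m ⟩
    m + length Redundant                     ∎
    where
    open ≤-Reasoning
    Reps : List (Pair n)
    Reps = filter isRep? E
    colour-injective : ∀ {f g} → f ∈ Reps → g ∈ Reps → colour f ≡ colour g → f ≡ g
    colour-injective f∈ g∈ f~g with ∈-filter⁻ isRep? {xs = E} f∈ | ∈-filter⁻ isRep? {xs = E} g∈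
    ... | f∈E , f≡rep | _ , g≡rep = trans f≡rep (trans (rep-determined f∈E f~g) (sym g≡rep))
    Reps≤m : length Reps ≤ m
    Reps≤m = subst (_≤ m) (length-map colour Reps)
      (unique⇒length≤n (map-unique colour (filter⁺ isRep? (pairs-unique ⊤)) colour-injective))

  pair-inside : ∀ {f} → f ∈ E → (S : Subset n) → proj₁ f ∈ₛ S → proj₂ f ∈ₛ S → f ∈ pairs S
  pair-inside {i , j} f∈ S i∈ j∈ = ∈-pairs⁺ i∈ j∈ (proj₂ (proj₂ (∈-pairs⁻ {S = ⊤} f∈)))

module Quads {n m : ℕ} (c : Fin n → Fin n → Fin m) (4≤n : 4 ≤ n) where
  open Representatives c
  open import Data.List.Membership.DecPropositional (_≟ᵖ_ {n}) using () renaming (_∈?_ to _∈ᵖ?_)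

  endpoints : Pair n → List (Fin n)
  endpoints f = proj₁ f ∷ proj₂ f ∷ proj₁ (rep f) ∷ proj₂ (rep f) ∷ []

  quadSpec : ∀ f → ∃ λ Q → fromList (endpoints f) ⊆ₛ Q × ∣ Q ∣ ≡ 4
  quadSpec f = pad 4 (fromList (endpoints f)) (∣∣≤length (fromList⁻ (endpoints f))) 4≤n

  quad : Pair n → Subset n
  quad f = proj₁ (quadSpec f)

  ∈-quad : ∀ f {y} → y ∈ endpoints f → y ∈ₛ quad f
  ∈-quad f y∈ = proj₁ (proj₂ (quadSpec f)) (fromList⁺ y∈)

  quads : List (Subset n)
  quads = deduplicate _≟ˢ_ (map quad Redundant)

  quad-source : ∀ {Q} → Q ∈ quads → ∃ λ f → f ∈ Redundant × Q ≡ quad f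
  quad-source Q∈ = ∈-map⁻ quad (∈-deduplicate⁻ _≟ˢ_ (map quad Redundant) Q∈)

  quads-uniform : ∀ {Q} → Q ∈ quads → ∣ Q ∣ ≡ 4
  quads-uniform Q∈ with quad-source Q∈
  ... | f , _ , refl = proj₂ (proj₂ (quadSpec f))

  H : Hypergraph4 n
  H = record { edges   = quads
             ; unique  = deduplicate-! _≟ˢ_ (map quad Redundant)
             ; uniform = All-tabulate quads-uniform }

  -- every redundant edge is one of the pairs of its quad, which is an edge of H ...
  redundant⊆pairsOfQuads : ∀ {f} → f ∈ Redundant → f ∈ concatMap pairs quads
  redundant⊆pairsOfQuads {f} f∈ = ∈-concatMap⁺ pairs (lose (∈-deduplicate⁺ _≟ˢ_ (∈-map⁺ quad f∈))
    (pair-inside (proj₁ (Redundant⁻ f∈)) (quad f) (∈-quad f (here refl)) (∈-quad f (there (here refl)))))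

  -- ... and each edge of H contains C(4,2) = 6 pairs
  redundant≤6quads : length Redundant ≤ 6 * length quads
  redundant≤6quads = subst (length Redundant ≤_)
    (length-concatMap pairs 6 quads (All-tabulate λ {Q} Q∈ → trans (length-pairs Q) (cong (_C 2) (quads-uniform Q∈))))
    (unique⊆⇒length≤ Redundant-unique redundant⊆pairsOfQuads)

  deficit≤6·edges : n C 2 ∸ m ≤ 6 * length (edges H)
  deficit≤6·edges = ≤-trans (m≤n+o⇒m∸n≤o (n C 2) m redundant-count) redundant≤6quads

  sources : ∀ (L : List (Subset n)) → Unique L → (∀ {Q} → Q ∈ L → Q ∈ quads) →
    ∃ λ F → (∀ {f} → f ∈ F → f ∈ Redundant) × Unique F × map quad F ≡ L
  sources []      _            _     = [] , (λ ()) , [] , refl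
  sources (Q ∷ L) (Q∉L ∷ uL) L⊆quads
    with quad-source (L⊆quads (here refl)) | sources L uL (λ Q∈ → L⊆quads (there Q∈))
  ... | f , f∈ , refl | F , F⊆R , uF , quadsF≡L = f ∷ F , f∷F⊆R , All-tabulate f∉F ∷ uF , cong (quad f ∷_) quadsF≡L
    where
    f∷F⊆R : ∀ {g} → g ∈ f ∷ F → g ∈ Redundant
    f∷F⊆R (here refl) = f∈
    f∷F⊆R (there g∈)  = F⊆R g∈
    f∉F : ∀ {g} → g ∈ F → f ≢ g
    f∉F {g} g∈ f≡g = All-lookup Q∉L (subst (quad g ∈_) quadsF≡L (∈-map⁺ quad g∈)) (cong quad f≡g)

  -- If the redundant edges F, with their representatives, lie inside S, then
  -- every colour on S is the colour of a pair of S outside F: of the pair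
  -- itself, or of its representative when it lies in F.
  colours-bound : ∀ (S : Subset n) (F : List (Pair n)) → Unique F → (∀ {f} → f ∈ F → f ∈ Redundant) →
    (∀ {f} → f ∈ F → ∀ {y} → y ∈ endpoints f → y ∈ₛ S) → length F + ∣ colorsOn c S ∣ ≤ ∣ S ∣ C 2
  colours-bound S F uF F⊆R F-inside = begin
    length F + ∣ colorsOn c S ∣                   ≤⟨ +-mono-≤ F≤inF colours≤outF ⟩
    length (filter inF? PS) + length (filter outF? PS) ≡⟨ length-partition inF? PS ⟩
    length PS                                     ≡⟨ length-pairs S ⟩
    ∣ S ∣ C 2                                     ∎
    where
    open ≤-Reasoning
    PS : List (Pair n)
    PS = pairs S
    inF? : (g : Pair n) → Dec (g ∈ F)
    inF? g = g ∈ᵖ? F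
    outF? : (g : Pair n) → Dec (g ∉ F)
    outF? g = ¬? (inF? g)
    f∈E : ∀ {f} → f ∈ F → f ∈ E
    f∈E f∈ = proj₁ (Redundant⁻ (F⊆R f∈))
    F⊆PS : ∀ {f} → f ∈ F → f ∈ PS
    F⊆PS f∈ = pair-inside (f∈E f∈) S (F-inside f∈ (here refl)) (F-inside f∈ (there (here refl)))
    rep∈PS : ∀ {f} → f ∈ F → rep f ∈ PS
    rep∈PS f∈ = pair-inside (rep-∈ (f∈E f∈)) S (F-inside f∈ (there (there (here refl))))
                                           (F-inside f∈ (there (there (there (here refl)))))
    -- representatives are not redundant
    rep∉F : ∀ {f} → f ∈ F → rep f ∉ F
    rep∉F f∈ rep∈ = proj₂ (Redundant⁻ (F⊆R rep∈)) (sym (rep-idempotent (f∈E f∈)))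
    F≤inF : length F ≤ length (filter inF? PS)
    F≤inF = unique⊆⇒length≤ uF (λ f∈ → ∈-filter⁺ inF? {xs = PS} (F⊆PS f∈) f∈)
    covered : ∀ {x} → x ∈ₛ colorsOn c S → x ∈ map colour (filter outF? PS)
    covered x∈ with colour-witness c S x∈
    ... | i , j , ij∈ , cij≡x with inF? (i , j)
    ...   | no ij∉F  = subst (_∈ _) cij≡x (∈-map⁺ colour (∈-filter⁺ outF? {xs = PS} ij∈ ij∉F))
    ...   | yes ij∈F = subst (_∈ _) (trans (rep-colour (i , j)) cij≡x)
                         (∈-map⁺ colour (∈-filter⁺ outF? {xs = PS} (rep∈PS ij∈F) (rep∉F ij∈F)))
    colours≤outF : ∣ colorsOn c S ∣ ≤ length (filter outF? PS)
    colours≤outF = subst (_ ≤_) (length-map colour (filter outF? PS)) (∣∣≤length covered)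

  no-configuration : (p q : ℕ) → p ≤ n → Good p q c → q ≤ p C 2 → ¬ HasConfig p ((p C 2 ∸ q) + 1) H
  no-configuration p q p≤n good q≤C (L , L⊆quads , uL , ∣L∣≡e , ∣⋃L∣≤p) with sources L uL L⊆quads
  ... | F , F⊆R , uF , quadsF≡L with pad p (⋃ L) ∣⋃L∣≤p p≤n
  ... | S , ⋃L⊆S , ∣S∣≡p = 1+n≰n (begin
    suc (p C 2)                  ≡⟨ sym e+q≡1+C ⟩
    (p C 2 ∸ q) + 1 + q          ≡⟨ cong (_+ q) (sym ∣F∣≡e) ⟩
    length F + q                 ≤⟨ +-monoʳ-≤ (length F) (good S ∣S∣≡p) ⟩
    length F + ∣ colorsOn c S ∣  ≤⟨ colours-bound S F uF F⊆R F-inside ⟩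
    ∣ S ∣ C 2                    ≡⟨ cong (_C 2) ∣S∣≡p ⟩
    p C 2                        ∎)
    where
    open ≤-Reasoning
    e+q≡1+C : (p C 2 ∸ q) + 1 + q ≡ suc (p C 2)
    e+q≡1+C = trans (+-assoc (p C 2 ∸ q) 1 q) (trans (+-suc (p C 2 ∸ q) q) (cong suc (m∸n+n≡m q≤C)))
    ∣F∣≡e : length F ≡ (p C 2 ∸ q) + 1
    ∣F∣≡e = trans (sym (length-map quad F)) (trans (cong length quadsF≡L) ∣L∣≡e)
    F-inside : ∀ {f} → f ∈ F → ∀ {y} → y ∈ endpoints f → y ∈ₛ S
    F-inside {f} f∈ y∈ = ⋃L⊆S (∈⋃ (∈-quad f y∈) (subst (quad f ∈_) quadsF≡L (∈-map⁺ quad f∈)))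

allSubsets : ∀ n → List (Subset n)
allSubsets zero    = [] ∷ []
allSubsets (suc n) = map (true ∷_) (allSubsets n) ++ map (false ∷_) (allSubsets n)

∈-allSubsets : ∀ {n} (S : Subset n) → S ∈ allSubsets n
∈-allSubsets []          = here refl
∈-allSubsets (true ∷ S)  = ∈-++⁺ˡ (∈-map⁺ (true ∷_) (∈-allSubsets S))
∈-allSubsets {suc n} (false ∷ S) = ∈-++⁺ʳ (map (true ∷_) (allSubsets n)) (∈-map⁺ (false ∷_) (∈-allSubsets S))

¬¬-greatest : ∀ {P : ℕ → Set} (k : ℕ) → (∀ ℓ → P ℓ → ℓ ≤ k) → ∀ {ℓ₀} → P ℓ₀ →
  ¬ ¬ (∃ λ m → P m × ∀ ℓ → P ℓ → ℓ ≤ m)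
¬¬-greatest          zero    bound {ℓ₀} Pℓ₀ no-greatest =
  no-greatest (ℓ₀ , Pℓ₀ , λ ℓ Pℓ → ≤-trans (bound ℓ Pℓ) z≤n)
¬¬-greatest {P = P} (suc k) bound Pℓ₀ no-greatest = ¬¬-greatest k bound′ Pℓ₀ no-greatest
  where
  -- suc k is not attained, since it would be the greatest element
  bound′ : ∀ ℓ → P ℓ → ℓ ≤ k
  bound′ ℓ Pℓ with m≤n⇒m<n∨m≡n (bound ℓ Pℓ)
  ... | inj₁ ℓ<1+k = ≤-pred ℓ<1+k
  ... | inj₂ refl  = ⊥-elim (no-greatest (suc k , Pℓ , bound))

-- f_4(n,v,e) exists (classically) once some hypergraph avoids (v,e)-configurations,
-- because no 4-uniform hypergraph has more edges than there are subsets of Fin n.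
¬¬-f4 : ∀ {n} v e (H : Hypergraph4 n) → ¬ HasConfig v e H → ¬ ¬ (∃ λ m → IsF4 n v e m)
¬¬-f4 {n} v e H H-free = ¬¬-map greatest⇒f4
  (¬¬-greatest {P = Size} (length (allSubsets n)) bounded (H , H-free , refl))
  where
  Size : ℕ → Set
  Size ℓ = Σ (Hypergraph4 n) λ H′ → ¬ HasConfig v e H′ × length (edges H′) ≡ ℓ
  bounded : ∀ ℓ → Size ℓ → ℓ ≤ length (allSubsets n)
  bounded _ (H′ , _ , refl) = unique⊆⇒length≤ (unique H′) (λ {S} _ → ∈-allSubsets S)
  greatest⇒f4 : (∃ λ m → Size m × ∀ ℓ → Size ℓ → ℓ ≤ m) → ∃ λ m → IsF4 n v e m
  greatest⇒f4 (m , size-m , greatest) = m , size-m , λ H′ H′-free → greatest _ (H′ , H′-free , refl)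

proposition5p1 : (p q : ℕ) → 4 ≤ p → qquad p < q → q ≤ p C 2 →
    (∀ k → ∃[ N ] ∀ n → N ≤ n → ∀ m → IsF4 n p ((p C 2 ∸ q) + 1) m → k * m ≤ n * n) →
    (∀ k → ∃[ N ] ∀ n → N ≤ n → ∀ m → IsG n p q m → k * ((n C 2) ∸ m) ≤ n * n)
proposition5p1 p q _ _ q≤C f4-small k with f4-small (6 * k)
... | N , f4-bound = N ⊔ (p ⊔ 4) , g-bound
  where
  g-bound : ∀ n → N ⊔ (p ⊔ 4) ≤ n → ∀ m → IsG n p q m → k * ((n C 2) ∸ m) ≤ n * n
  g-bound n n-large m ((c , _ , good) , _) = decidable-stable (k * ((n C 2) ∸ m) ≤? n * n)
    (¬¬-map via-f4 (¬¬-f4 p e H H-free))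
    where
    e : ℕ
    e = (p C 2 ∸ q) + 1
    N≤n : N ≤ n
    N≤n = m⊔n≤o⇒m≤o N (p ⊔ 4) n-large
    p≤n : p ≤ n
    p≤n = m⊔n≤o⇒m≤o p 4 (m⊔n≤o⇒n≤o N (p ⊔ 4) n-large)
    4≤n : 4 ≤ n
    4≤n = m⊔n≤o⇒n≤o p 4 (m⊔n≤o⇒n≤o N (p ⊔ 4) n-large)
    open Quads c 4≤n
    H-free : ¬ HasConfig p e H
    H-free = no-configuration p q p≤n good q≤C
    via-f4 : (∃ λ f → IsF4 n p e f) → k * ((n C 2) ∸ m) ≤ n * n
    via-f4 (f , is-f4) = begin
      k * ((n C 2) ∸ m)  ≤⟨ *-monoʳ-≤ k (≤-trans deficit≤6·edges (*-monoʳ-≤ 6 (proj₂ is-f4 H H-free))) ⟩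
      k * (6 * f)        ≡⟨ trans (sym (*-assoc k 6 f)) (cong (_* f) (*-comm k 6)) ⟩
      6 * k * f          ≤⟨ f4-bound n N≤n f is-f4 ⟩
      n * n              ∎
      where open ≤-Reasoning
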